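{- Let $m\geq 2$ be an integer and let $b_m(n)$ denote the $m$-ary partition function. Then there exists $N$ such that $b_m(a)b_m(b)>b_m(a+b)$ for all integers $a,b\geq N$.
   Context: For an integer $m\geq 2$ and $n\in\mathbb{N}$ (non-negative integers), $b_m(n)$ is the number of partitions of $n$ into parts from the set $\{m^i: i\in\mathbb{N}\}$, i.e. the number of ways to write $n$ as a sum of powers of $m$ (order of summands disregarded), with $b_m(0)=1$. Equivalently, $\sum_{n\ge0} b_m(n)x^n=\prod_{i\ge0}(1-x^{m^i})^{ -1}$. -}

module Defs where

open import Data.Nat using (ℕ; zero; suc; _+_; _*_; _∸_; _^_; _≤ᵇ_)
open import Data.Bool using (if_then_else_)

-- countUpTo m k n = number of partitions of n into parts from {m^0, m^1, ..., m^k}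
-- (multisets of such powers summing to n).
-- For k+1: choose the multiplicity j of the part m^(k+1) (j * m^(k+1) ≤ n, so j ≤ n),
-- and partition the remainder using parts m^0..m^k.
sumMult : (ℕ → ℕ) → ℕ → ℕ → ℕ → ℕ
sumMult f p n zero = f n
sumMult f p n (suc j) =
  sumMult f p n j + (if (suc j * p) ≤ᵇ n then f (n ∸ suc j * p) else 0)

countUpTo : ℕ → ℕ → ℕ → ℕ
countUpTo m zero n = 1
countUpTo m (suc k) n = sumMult (countUpTo m k) (m ^ suc k) n n

-- b m n = m-ary partition function b_m(n): partitions of n into powers of m.
-- For m ≥ 2 every power m^i with i > n exceeds n, so parts m^0..m^n suffice.
b : ℕ → ℕ → ℕ
b m n = countUpTo m n n

{-# OPTIONS --safe #-}
module Submission where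

open import Data.Bool using (false; if_then_else_)
open import Data.Nat
open import Data.Nat.Induction using (<-rec)
open import Data.Nat.Properties
open import Algebra.Properties.CommutativeSemigroup +-commutativeSemigroup using (interchange)
open import Data.Product using (∃-syntax; _,_)
open import Data.Sum using (_⊎_; inj₁; inj₂)
open import Function using (_∘′_)
open import Relation.Binary.Definitions using (tri<; tri≈; tri>)
open import Relation.Binary.PropositionalEquality
open import Relation.Nullary.Decidable using (yes; no)
open import Relation.Nullary.Reflects using (ofⁿ; fromEquivalence; det)
open import Defs

-- A partition of n+1 into m^0, …, m^(k+1) either has a part 1 or is m times a partition of
-- (n+1)/m into m^0, …, m^k.  In inequality form, and by induction on k (splitting off
-- the largest part) this gives count (k+1) (n+1) ≤ count (k+1) n + count k t whenever
-- n+1 < m(t+1); at full level, b(n+1) ≤ b(n) + b(t), hence b(a + c) ≤ (a+1) b(c) for a ≤ c.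
-- Partitions into 1, m and m² alone already grow quadratically, so b(a) > a + 1 for large a,
-- and then (a+1) b(c) < b(a) b(c).

open ≤-Reasoning

below-or-above : ∀ p n → n < p ⊎ ∃[ z ] p + z ≡ n
below-or-above p n with n <? p
... | yes n<p = inj₁ n<p
... | no  n≮p = inj₂ (m≤n⇒∃[o]m+o≡n (≮⇒≥ n≮p))

suc-below-at-or-above : ∀ p n → suc n < p ⊎ suc n ≡ p ⊎ ∃[ z ] p + z ≡ n
suc-below-at-or-above p n with <-cmp (suc n) p
... | tri< 1+n<p _ _ = inj₁ 1+n<p
... | tri≈ _ 1+n≡p _ = inj₂ (inj₁ 1+n≡p)
... | tri> _ _ p<1+n = inj₂ (inj₂ (m≤n⇒∃[o]m+o≡n (≤-pred p<1+n)))

suc-mono⇒mono : ∀ (f : ℕ → ℕ) → (∀ n → f n ≤ f (suc n)) → ∀ {x y} → x ≤ y → f x ≤ f y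
suc-mono⇒mono f f-suc {y = zero}  z≤n = ≤-refl
suc-mono⇒mono f f-suc {y = suc y} x≤1+y with m≤n⇒m<n∨m≡n x≤1+y
... | inj₁ x<1+y = ≤-trans (suc-mono⇒mono f f-suc (≤-pred x<1+y)) (f-suc y)
... | inj₂ refl  = ≤-refl

m*n≤x<m*[1+t]⇒n≤t : ∀ m n {x t} → m * n ≤ x → x < m * suc t → n ≤ t
m*n≤x<m*[1+t]⇒n≤t m n {t = t} mn≤x x<m[1+t] = ≤-pred (*-cancelˡ-< m n (suc t) (≤-<-trans mn≤x x<m[1+t]))

1+[m*n+z]<m*[1+n+t]⇒1+z<m*[1+t] : ∀ m n {z t} → suc (m * n + z) < m * suc (n + t) → suc z < m * suc t
1+[m*n+z]<m*[1+n+t]⇒1+z<m*[1+t] m n {z} {t} =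
  +-cancelˡ-< (m * n) (suc z) (m * suc t) ∘′ subst₂ _<_ (sym (+-suc (m * n) z)) m[1+n+t]≡m*n+m[1+t]
  where
  m[1+n+t]≡m*n+m[1+t] : m * suc (n + t) ≡ m * n + m * suc t
  m[1+n+t]≡m*n+m[1+t] = trans (cong (m *_) (sym (+-suc n t))) (*-distribˡ-+ m n (suc t))

<⇒≤ᵇ≡false : ∀ {m n} → n < m → (m ≤ᵇ n) ≡ false
<⇒≤ᵇ≡false {m} {n} n<m = det (≤ᵇ-reflects-≤ m n) (ofⁿ (<⇒≱ n<m))

≤ᵇ-cancelˡ : ∀ p q n → (p + q ≤ᵇ p + n) ≡ (q ≤ᵇ n)
≤ᵇ-cancelˡ p q n = det (≤ᵇ-reflects-≤ (p + q) (p + n))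
  (fromEquivalence (+-monoʳ-≤ p ∘′ ≤ᵇ⇒≤ q n) (≤⇒≤ᵇ ∘′ +-cancelˡ-≤ p q n))

drop-vanishing-summand : ∀ s {q n x} → n < q → s + (if q ≤ᵇ n then x else 0) ≡ s
drop-vanishing-summand s n<q rewrite <⇒≤ᵇ≡false n<q = +-identityʳ s

summand-shift : ∀ (f : ℕ → ℕ) p q n →
  (if p + q ≤ᵇ p + n then f (p + n ∸ (p + q)) else 0) ≡ (if q ≤ᵇ n then f (n ∸ q) else 0)
summand-shift f p q n rewrite ≤ᵇ-cancelˡ p q n | [m+n]∸[m+o]≡n∸o p n q = refl

module _ (f : ℕ → ℕ) (p : ℕ) where

  f≤sumMult : ∀ n j → f n ≤ sumMult f p n j
  f≤sumMult n zero    = ≤-refl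
  f≤sumMult n (suc j) = ≤-trans (f≤sumMult n j) (m≤m+n _ _)

  sumMult-below : ∀ {n} j → n < p → sumMult f p n j ≡ f n
  sumMult-below zero    n<p = refl
  sumMult-below (suc j) n<p =
    trans (drop-vanishing-summand _ (<-≤-trans n<p (m≤m+n p (j * p)))) (sumMult-below j n<p)

  sumMult-shift : ∀ z j → sumMult f p (p + z) (suc j) ≡ f (p + z) + sumMult f p z j
  sumMult-shift z zero    = cong (f (p + z) +_) (summand-shift f p 0 z)
  sumMult-shift z (suc j) =
    trans (cong₂ _+_ (sumMult-shift z j) (summand-shift f p (suc j * p) z)) (+-assoc (f (p + z)) _ _)

  sumMult-stable : .{{_ : NonZero p}} → ∀ d n → sumMult f p n (d + n) ≡ sumMult f p n n
  sumMult-stable zero    n = refl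
  sumMult-stable (suc d) n =
    trans (drop-vanishing-summand _ (<-≤-trans (s≤s (m≤n+m n d)) (m≤m*n (suc (d + n)) p)))
          (sumMult-stable d n)

sumMult-split : ∀ f p .{{_ : NonZero p}} z →
  sumMult f p (p + z) (p + z) ≡ f (p + z) + sumMult f p z z
sumMult-split f p@(suc p-1) z =
  trans (sumMult-shift f p z (p-1 + z)) (cong (f (p + z) +_) (sumMult-stable f p p-1 z))

module Counting (m : ℕ) .{{_ : NonZero m}} where

  count : ℕ → ℕ → ℕ
  count = countUpTo m

  count-below : ∀ k {n} → n < m ^ suc k → count (suc k) n ≡ count k n
  count-below k {n} = sumMult-below (count k) (m ^ suc k) n

  count-split : ∀ k {n} z → m ^ suc k + z ≡ n → count (suc k) n ≡ count k n + count (suc k) z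
  count-split k z refl = sumMult-split (count k) (m ^ suc k) {{m^n≢0 m (suc k)}} z

  count-zero : ∀ k → count k 0 ≡ 1
  count-zero zero    = refl
  count-zero (suc k) = count-zero k

  count-mono-level : ∀ k n → count k n ≤ count (suc k) n
  count-mono-level k n = f≤sumMult (count k) (m ^ suc k) n n

  count-positive : ∀ k n → 0 < count k n
  count-positive zero    n = z<s
  count-positive (suc k) n = <-≤-trans (count-positive k n) (count-mono-level k n)

  count-level-gain : ∀ k {t} → m ^ suc k ≤ t → count k t + 1 ≤ count (suc k) t
  count-level-gain k P≤t with m≤n⇒∃[o]m+o≡n P≤t
  ... | t′ , refl = begin
    count k (m ^ suc k + t′) + 1                        ≤⟨ +-monoʳ-≤ _ (count-positive (suc k) t′) ⟩
    count k (m ^ suc k + t′) + count (suc k) t′         ≡⟨ count-split k t′ refl ⟨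
    count (suc k) (m ^ suc k + t′)                      ∎

  count-suc-mono : ∀ k n → count k n ≤ count k (suc n)
  count-suc-mono zero    n = ≤-refl
  count-suc-mono (suc k) = <-rec _ step
    where
    P = m ^ suc k
    step : ∀ n → (∀ {j} → j < n → count (suc k) j ≤ count (suc k) (suc j)) →
           count (suc k) n ≤ count (suc k) (suc n)
    step n rec with below-or-above P n
    ... | inj₁ n<P = begin
      count (suc k) n        ≡⟨ count-below k n<P ⟩
      count k n              ≤⟨ count-suc-mono k n ⟩
      count k (suc n)        ≤⟨ count-mono-level k (suc n) ⟩
      count (suc k) (suc n)  ∎
    ... | inj₂ (z , refl) = begin
      count (suc k) (P + z)                          ≡⟨ count-split k z refl ⟩
      count k (P + z) + count (suc k) z              ≤⟨ +-mono-≤ (count-suc-mono k (P + z))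
                                                                 (rec (m<n+m z (m^n>0 m (suc k)))) ⟩
      count k (suc (P + z)) + count (suc k) (suc z)  ≡⟨ count-split k (suc z) (+-suc P z) ⟨
      count (suc k) (suc (P + z))                    ∎

  count-mono : ∀ k {x y} → x ≤ y → count k x ≤ count k y
  count-mono k = suc-mono⇒mono (count k) (count-suc-mono k)

  -- The hypothesis says ⌊(n+1)/m⌋ ≤ t.
  IncrementBound : ℕ → Set
  IncrementBound k = ∀ n t → suc n < m * suc t → count (suc k) (suc n) ≤ count (suc k) n + count k t

  count₁-increment : ∀ n → count 1 (suc n) ≤ count 1 n + 1
  count₁-increment = <-rec _ step
    where
    step : ∀ n → (∀ {j} → j < n → count 1 (suc j) ≤ count 1 j + 1) → count 1 (suc n) ≤ count 1 n + 1
    step n rec with suc-below-at-or-above (m ^ 1) n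
    ... | inj₁ 1+n<m = ≤-trans (≤-reflexive (count-below 0 1+n<m)) (m≤n+m 1 _)
    ... | inj₂ (inj₁ 1+n≡m) = begin
      count 1 (suc n)         ≡⟨ count-split 0 0 (trans (+-identityʳ _) (sym 1+n≡m)) ⟩
      1 + count 1 0           ≡⟨ cong (1 +_) (count-zero 1) ⟩
      1 + count 0 n           ≡⟨ cong (_+ 1) (count-below 0 (≤-reflexive 1+n≡m)) ⟨
      count 1 n + 1           ∎
    ... | inj₂ (inj₂ (z , refl)) = begin
      count 1 (suc (m ^ 1 + z))  ≡⟨ count-split 0 (suc z) (+-suc _ z) ⟩
      1 + count 1 (suc z)        ≤⟨ +-monoʳ-≤ 1 (rec (m<n+m z (m^n>0 m 1))) ⟩
      1 + (count 1 z + 1)        ≡⟨ +-assoc 1 _ 1 ⟨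
      1 + count 1 z + 1          ≡⟨ cong (_+ 1) (count-split 0 z refl) ⟨
      count 1 (m ^ 1 + z) + 1    ∎

  increment-step : ∀ k → IncrementBound k → IncrementBound (suc k)
  increment-step k bound n = <-rec _ step n
    where
    M = m ^ suc k
    Q = m ^ suc (suc k)

    step : ∀ n → (∀ {j} → j < n → ∀ t → suc j < m * suc t →
                    count (2 + k) (suc j) ≤ count (2 + k) j + count (suc k) t) →
           ∀ t → suc n < m * suc t → count (2 + k) (suc n) ≤ count (2 + k) n + count (suc k) t
    step n rec t lt with suc-below-at-or-above Q n
    ... | inj₁ 1+n<Q = begin
      count (2 + k) (suc n)          ≡⟨ count-below (suc k) 1+n<Q ⟩
      count (1 + k) (suc n)          ≤⟨ bound n t lt ⟩
      count (1 + k) n + count k t    ≤⟨ +-mono-≤ (count-mono-level (suc k) n) (count-mono-level k t) ⟩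
      count (2 + k) n + count (1 + k) t ∎
    ... | inj₂ (inj₁ 1+n≡Q) = begin
      count (2 + k) (suc n)                    ≡⟨ count-split (suc k) 0 (trans (+-identityʳ Q) (sym 1+n≡Q)) ⟩
      count (1 + k) (suc n) + count (2 + k) 0  ≡⟨ cong (count (1 + k) (suc n) +_) (count-zero (2 + k)) ⟩
      count (1 + k) (suc n) + 1                ≤⟨ +-monoˡ-≤ 1 (bound n t lt) ⟩
      count (1 + k) n + count k t + 1          ≡⟨ +-assoc (count (1 + k) n) _ 1 ⟩
      count (1 + k) n + (count k t + 1)        ≤⟨ +-mono-≤ (count-mono-level (suc k) n)
                                                           (count-level-gain k M≤t) ⟩
      count (2 + k) n + count (1 + k) t        ∎
      where M≤t = m*n≤x<m*[1+t]⇒n≤t m M (≤-reflexive (sym 1+n≡Q)) lt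
    ... | inj₂ (inj₂ (z , refl))
        with m≤n⇒∃[o]m+o≡n (m*n≤x<m*[1+t]⇒n≤t m M (m≤m+n Q z) (<-trans (n<1+n _) lt))
    ...   | t′ , refl = begin
      count (2 + k) (suc (Q + z))
        ≡⟨ count-split (suc k) (suc z) (+-suc Q z) ⟩
      count (1 + k) (suc (Q + z)) + count (2 + k) (suc z)
        ≤⟨ +-mono-≤ (bound (Q + z) (M + t′) lt)
                    (rec (m<n+m z (m^n>0 m (2 + k))) t′ (1+[m*n+z]<m*[1+n+t]⇒1+z<m*[1+t] m M lt)) ⟩
      (count (1 + k) (Q + z) + count k (M + t′)) + (count (2 + k) z + count (1 + k) t′)
        ≡⟨ interchange (count (1 + k) (Q + z)) _ _ _ ⟩
      (count (1 + k) (Q + z) + count (2 + k) z) + (count k (M + t′) + count (1 + k) t′)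
        ≡⟨ cong₂ _+_ (count-split (suc k) z refl) (count-split k t′ refl) ⟨
      count (2 + k) (Q + z) + count (1 + k) (M + t′)
        ∎

  count-increment : ∀ k → IncrementBound k
  count-increment zero    n _ _ = count₁-increment n
  count-increment (suc k) = increment-step k (count-increment k)

  count₁-lower : ∀ x → suc x ≤ m * count 1 x
  count₁-lower = <-rec _ step
    where
    step : ∀ x → (∀ {j} → j < x → suc j ≤ m * count 1 j) → suc x ≤ m * count 1 x
    step x rec with below-or-above (m ^ 1) x
    ... | inj₁ x<m = ≤-trans x<m (≤-reflexive (cong (m *_) (sym (count-below 0 x<m))))
    ... | inj₂ (z , refl) = begin
      suc (m ^ 1 + z)               ≡⟨ +-suc (m * 1) z ⟨
      m * 1 + suc z                 ≤⟨ +-monoʳ-≤ (m * 1) (rec (m<n+m z (m^n>0 m 1))) ⟩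
      m * 1 + m * count 1 z         ≡⟨ *-distribˡ-+ m 1 (count 1 z) ⟨
      m * (1 + count 1 z)           ≡⟨ cong (m *_) (count-split 0 z refl) ⟨
      m * count 1 (m ^ 1 + z)       ∎

  count-suc-lower : ∀ k i x → i * count k x ≤ count (suc k) (i * m ^ suc k + x)
  count-suc-lower k zero    x = z≤n
  count-suc-lower k (suc i) x = begin
    count k x + i * count k x
      ≤⟨ +-mono-≤ (count-mono k (m≤n+m x (suc i * P))) (count-suc-lower k i x) ⟩
    count k (suc i * P + x) + count (suc k) (i * P + x)
      ≡⟨ count-split k (i * P + x) (sym (+-assoc P (i * P) x)) ⟨
    count (suc k) (suc i * P + x)
      ∎
    where P = m ^ suc k

module Growth (m : ℕ) (2≤m : 2 ≤ m) where

  private instance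
    m≢0 : NonZero m
    m≢0 = >-nonZero (<-≤-trans z<s 2≤m)

  open Counting m

  n<m^n : ∀ n → n < m ^ n
  n<m^n zero    = z<s
  n<m^n (suc n) = ≤-<-trans (n<m^n n) (^-monoʳ-< m 2≤m (n<1+n n))

  count-stable : ∀ d n → count (d + n) n ≡ b m n
  count-stable zero    n = refl
  count-stable (suc d) n =
    trans (count-below (d + n) (≤-<-trans (m≤n+m n (suc d)) (n<m^n (suc d + n)))) (count-stable d n)

  count≤b : ∀ k n → count k n ≤ b m n
  count≤b k n with ≤-total k n
  ... | inj₁ k≤n = suc-mono⇒mono (λ j → count j n) (λ j → count-mono-level j n) k≤n
  ... | inj₂ n≤k = ≤-reflexive (trans (cong (λ j → count j n) (sym (m∸n+n≡m n≤k))) (count-stable (k ∸ n) n))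

  b-positive : ∀ n → 0 < b m n
  b-positive n = count-positive n n

  b-increment : ∀ n t → suc n < m * suc t → b m (suc n) ≤ b m n + b m t
  b-increment n t lt = begin
    b m (suc n)                  ≤⟨ count-increment n n t lt ⟩
    count (suc n) n + count n t  ≤⟨ +-mono-≤ (≤-reflexive (count-stable 1 n)) (count≤b n t) ⟩
    b m n + b m t                ∎

  b-linear-bound : ∀ i c → i ≤ c → b m (i + c) ≤ suc i * b m c
  b-linear-bound zero    c _      = ≤-reflexive (sym (*-identityˡ (b m c)))
  b-linear-bound (suc i) c 1+i≤c = begin
    b m (suc i + c)        ≤⟨ b-increment (i + c) c 1+i+c<m[1+c] ⟩
    b m (i + c) + b m c    ≤⟨ +-monoˡ-≤ (b m c) (b-linear-bound i c (<⇒≤ 1+i≤c)) ⟩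
    suc i * b m c + b m c  ≡⟨ +-comm (suc i * b m c) (b m c) ⟩
    suc (suc i) * b m c    ∎
    where
    1+i+c<m[1+c] : suc (i + c) < m * suc c
    1+i+c<m[1+c] = begin-strict
      suc i + c          ≤⟨ +-monoˡ-≤ c 1+i≤c ⟩
      c + c              <⟨ +-mono-≤-< (n≤1+n c) (n<1+n c) ⟩
      suc c + suc c      ≡⟨ cong (suc c +_) (+-identityʳ (suc c)) ⟨
      2 * suc c          ≤⟨ *-monoˡ-≤ (suc c) 2≤m ⟩
      m * suc c          ∎

  count₂-lower : ∀ x → 2 * suc x ≤ count 2 ((2 * m) * m ^ 2 + x)
  count₂-lower x = begin
    2 * suc x            ≤⟨ *-monoʳ-≤ 2 (count₁-lower x) ⟩
    2 * (m * count 1 x)  ≡⟨ *-assoc 2 m (count 1 x) ⟨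
    (2 * m) * count 1 x  ≤⟨ count-suc-lower 1 (2 * m) x ⟩
    count 2 ((2 * m) * m ^ 2 + x) ∎

  threshold : ℕ
  threshold = D + D
    where D = (2 * m) * m ^ 2

  suc<b : ∀ {a} → threshold ≤ a → suc a < b m a
  suc<b {a} N≤a with m≤n⇒∃[o]m+o≡n N≤a
  ... | y , refl = begin-strict
    suc (D + D + y)          ≡⟨ cong suc (+-assoc D D y) ⟩
    suc (D + (D + y))        <⟨ suc[d+x]<2*suc[x] (m≤m+n D y) ⟩
    2 * suc (D + y)          ≤⟨ count₂-lower (D + y) ⟩
    count 2 (D + (D + y))    ≤⟨ count≤b 2 (D + (D + y)) ⟩
    b m (D + (D + y))        ≡⟨ cong (b m) (+-assoc D D y) ⟨
    b m (D + D + y)          ∎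
    where
    D = (2 * m) * m ^ 2
    suc[d+x]<2*suc[x] : ∀ {d x} → d ≤ x → suc (d + x) < 2 * suc x
    suc[d+x]<2*suc[x] {d} {x} d≤x = begin-strict
      suc (d + x)      ≤⟨ s≤s (+-monoˡ-≤ x d≤x) ⟩
      suc (x + x)      <⟨ s≤s (+-monoʳ-< x (n<1+n x)) ⟩
      suc (x + suc x)  ≡⟨ cong (λ w → suc (x + suc w)) (+-identityʳ x) ⟨
      2 * suc x        ∎

  b-submultiplicative-ordered : ∀ {a c} → threshold ≤ a → a ≤ c → b m (a + c) < b m a * b m c
  b-submultiplicative-ordered {a} {c} N≤a a≤c = begin-strict
    b m (a + c)     ≤⟨ b-linear-bound a c a≤c ⟩
    suc a * b m c   <⟨ *-monoˡ-< (b m c) {{>-nonZero (b-positive c)}} (suc<b N≤a) ⟩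
    b m a * b m c   ∎

  b-submultiplicative : ∀ a c → threshold ≤ a → threshold ≤ c → b m (a + c) < b m a * b m c
  b-submultiplicative a c N≤a N≤c with ≤-total a c
  ... | inj₁ a≤c = b-submultiplicative-ordered N≤a a≤c
  ... | inj₂ c≤a = subst₂ _<_ (cong (b m) (+-comm c a)) (*-comm (b m c) (b m a))
                          (b-submultiplicative-ordered N≤c c≤a)

theorem4p8 : (m : ℕ) → 2 ≤ m →
    ∃[ N ] ((a c : ℕ) → N ≤ a → N ≤ c → b m (a + c) < b m a * b m c)
theorem4p8 m 2≤m = threshold , b-submultiplicative
  where open Growth m 2≤m
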